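{- If $L$ is accepted by a DFA with $n$ states and $L$ is not factor-closed, then there exists a witness $(v,w)$ to the failure of factor-closure with $|w| \le 2n^2 + n - 1$.
   Context: A word $v$ is a factor of $w$ if $w = xvy$ for some words $x,y$. $L$ is factor-closed if $w \in L$ and $v$ a factor of $w$ imply $v \in L$. A witness to the failure of factor-closure is a pair $(v,w)$ with $w \in L$, $v \notin L$, and $v$ a factor of $w$. -}

module Defs where

open import Data.Nat using (ℕ; _+_; _*_; _∸_)
open import Data.Fin using (Fin)
open import Data.Bool using (Bool; true)
open import Data.List using (List; []; _∷_; _++_; length)
open import Data.Product using (Σ; ∃; ∃-syntax; _×_; _,_)
open import Relation.Binary.PropositionalEquality using (_≡_)
open import Relation.Nullary using (¬_)

Word : Set → Set
Word A = List A

record DFA (A : Set) (n : ℕ) : Set where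
  field
    δ     : Fin n → A → Fin n
    start : Fin n
    final : Fin n → Bool

open DFA public

δ* : ∀ {A n} → DFA A n → Fin n → Word A → Fin n
δ* M q []       = q
δ* M q (a ∷ w)  = δ* M (δ M q a) w

Accepts : ∀ {A n} → DFA A n → Word A → Set
Accepts M w = final M (δ* M (start M) w) ≡ true

Factor : ∀ {A} → Word A → Word A → Set
Factor {A} v w = ∃[ x ] ∃[ y ] (w ≡ x ++ v ++ y)

FactorClosed : ∀ {A} → (Word A → Set) → Set
FactorClosed {A} L = ∀ (v w : Word A) → L w → Factor v w → L v

Witness : ∀ {A} → (Word A → Set) → Word A → Word A → Set
Witness L v w = L w × ¬ L v × Factor v w

-- A witness (v, xvy) survives replacing x, v and y by shorter words as long as the
-- states that matter are preserved: the state reached after x, the pair of states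
-- reached by reading v from the start state and from the state after x, and the
-- state reached after y. Cutting loops (pigeonhole) makes x and y shorter than n and
-- v shorter than n², whence |xvy| ≤ 2n² + n − 1. Since a witness of bounded length is
-- a decidable property, the classical hypothesis ¬ FactorClosed yields one.
module Submission where

open import Defs
open import Data.Product using (∃; ∃-syntax; _×_; _,_)
open import Data.Nat using (ℕ; zero; suc; _+_; _*_; _∸_; _≤_; z≤n; s≤s; _<_; _⊓_; _<?_; _≤?_)
open import Data.Nat.Properties
open import Data.Nat.Induction using (<-wellFounded)
open import Data.Fin using (Fin; toℕ)
open import Data.Fin.Properties using (pigeonhole; toℕ≤pred[n]; *↔×)
open import Data.List using (List; []; _∷_; length; _++_; take; drop; foldl; allFin; cartesianProductWith)
open import Data.List.Properties using (length-++; length-++-≤ˡ; length-++-≤ʳ; length-take; length-drop; take++drop≡id; foldl-++)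
open import Data.List.Relation.Unary.Any using (here; there; any?; satisfied)
open import Data.List.Membership.Propositional using (_∈_; lose)
open import Data.List.Membership.Propositional.Properties using (∈-allFin; ∈-cartesianProductWith⁺)
open import Data.Bool using (true) renaming (_≟_ to _≟ᵇ_)
open import Data.Empty using (⊥-elim)
open import Data.Product.Properties using (×-≡,≡←≡)
open import Function using (_↣_; Injection)
open import Function.Construct.Identity using (↣-id)
open import Function.Properties.Inverse using (↔⇒↣; ↔-sym)
open import Induction.WellFounded using (Acc; acc)
open import Relation.Nullary using (¬_; Dec; yes; no)
open import Relation.Nullary.Decidable using (_×-dec_; ¬?; decidable-stable)
open import Relation.Unary using (Decidable)
open import Relation.Binary.PropositionalEquality

length-take++drop< : ∀ {A : Set} (w : List A) {i j} → i < j → j ≤ length w →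
                     length (take i w ++ drop j w) < length w
length-take++drop< w {i} {j} i<j j≤∣w∣ = begin-strict
  length (take i w ++ drop j w) ≡⟨ length-++ (take i w) ⟩
  length (take i w) + length (drop j w) ≡⟨ cong₂ _+_ (length-take i w) (length-drop j w) ⟩
  (i ⊓ length w) + (length w ∸ j) ≡⟨ cong (_+ (length w ∸ j)) (m≤n⇒m⊓n≡m (≤-trans (<⇒≤ i<j) j≤∣w∣)) ⟩
  i + (length w ∸ j) <⟨ +-monoˡ-< (length w ∸ j) i<j ⟩
  j + (length w ∸ j) ≡⟨ m+[n∸m]≡n j≤∣w∣ ⟩
  length w ∎
  where open ≤-Reasoning

module _ {A S : Set} {N : ℕ} (step : S → A → S) (encode : S ↣ Fin N) where

  open Injection encode using (to; injective)

  foldl-cutLoop : ∀ s (w : List A) i j → foldl step s (take i w) ≡ foldl step s (take j w) →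
                  foldl step s (take i w ++ drop j w) ≡ foldl step s w
  foldl-cutLoop s w i j loop = begin
    foldl step s (take i w ++ drop j w)           ≡⟨ foldl-++ step s (take i w) (drop j w) ⟩
    foldl step (foldl step s (take i w)) (drop j w) ≡⟨ cong (λ t → foldl step t (drop j w)) loop ⟩
    foldl step (foldl step s (take j w)) (drop j w) ≡⟨ foldl-++ step s (take j w) (drop j w) ⟨
    foldl step s (take j w ++ drop j w)           ≡⟨ cong (foldl step s) (take++drop≡id j w) ⟩
    foldl step s w ∎
    where open ≡-Reasoning

  -- The N + 1 prefixes of length ≤ N cannot all reach distinct states.
  pumpDown-once : ∀ s (w : List A) → N ≤ length w →
                  ∃[ w′ ] foldl step s w′ ≡ foldl step s w × length w′ < length w
  pumpDown-once s w N≤∣w∣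
    with i , j , i<j , same ← pigeonhole (s≤s N≤∣w∣) (λ k → to (foldl step s (take (toℕ k) w)))
    = take (toℕ i) w ++ drop (toℕ j) w
    , foldl-cutLoop s w (toℕ i) (toℕ j) (injective same)
    , length-take++drop< w i<j (toℕ≤pred[n] j)

  pumpDown : ∀ s (w : List A) → ∃[ w′ ] foldl step s w′ ≡ foldl step s w × length w′ < N
  pumpDown s w = go w (<-wellFounded (length w))
    where
    go : ∀ w → Acc _<_ (length w) → ∃[ w′ ] foldl step s w′ ≡ foldl step s w × length w′ < N
    go w (acc shorter) with length w <? N
    ... | yes short = w , refl , short
    ... | no long
      with w′ , same , w′<w ← pumpDown-once s w (≮⇒≥ long)
      with w″ , same′ , short ← go w′ (shorter w′<w)
      = w″ , trans same′ same , short

step-× : ∀ {A S T : Set} → (S → A → S) → (T → A → T) → S × T → A → S × T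
step-× f g (s , t) a = f s a , g t a

foldl-× : ∀ {A S T : Set} (f : S → A → S) (g : T → A → T) s t (w : List A) →
          foldl (step-× f g) (s , t) w ≡ (foldl f s w , foldl g t w)
foldl-× f g s t []      = refl
foldl-× f g s t (a ∷ w) = foldl-× f g (f s a) (g t a) w

words≤ : (k m : ℕ) → List (Word (Fin k))
words≤ k zero    = [] ∷ []
words≤ k (suc m) = [] ∷ cartesianProductWith _∷_ (allFin k) (words≤ k m)

∈-words≤ : ∀ {k} m (w : Word (Fin k)) → length w ≤ m → w ∈ words≤ k m
∈-words≤ zero    []      _         = here refl
∈-words≤ (suc m) []      _         = here refl
∈-words≤ (suc m) (a ∷ w) (s≤s ∣w∣≤m) =
  there (∈-cartesianProductWith⁺ _∷_ (∈-allFin a) (∈-words≤ m w ∣w∣≤m))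

∃-bounded? : ∀ {k} m {P : Word (Fin k) → Set} → Decidable P →
             (∀ w → P w → length w ≤ m) → Dec (∃ P)
∃-bounded? m P? bounded with any? P? (words≤ _ m)
... | yes found = yes (satisfied found)
... | no  none  = no λ (w , pw) → none (lose (∈-words≤ m w (bounded w pw)) pw)

module _ {k n : ℕ} (M : DFA (Fin k) n) where

  δ*≡foldl : ∀ q (w : Word (Fin k)) → δ* M q w ≡ foldl (δ M) q w
  δ*≡foldl q []      = refl
  δ*≡foldl q (a ∷ w) = δ*≡foldl (δ M q a) w

  δ*-++ : ∀ q (u v : Word (Fin k)) → δ* M q (u ++ v) ≡ δ* M (δ* M q u) v
  δ*-++ q []      v = refl
  δ*-++ q (a ∷ u) v = δ*-++ (δ M q a) u v

  δ*-++³ : ∀ q (x v y : Word (Fin k)) → δ* M q (x ++ v ++ y) ≡ δ* M (δ* M (δ* M q x) v) y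
  δ*-++³ q x v y = trans (δ*-++ q x (v ++ y)) (δ*-++ (δ* M q x) v y)

  accepts? : Decidable (Accepts M)
  accepts? w = final M (δ* M (start M) w) ≟ᵇ true

  Accepts-resp : ∀ u w → δ* M (start M) u ≡ δ* M (start M) w → Accepts M u → Accepts M w
  Accepts-resp _ _ same = subst (λ q → final M q ≡ true) same

  pumpDown-δ* : ∀ q (w : Word (Fin k)) → ∃[ w′ ] δ* M q w′ ≡ δ* M q w × length w′ < n
  pumpDown-δ* q w
    with w′ , same , short ← pumpDown (δ M) (↣-id _) q w
    = w′ , trans (δ*≡foldl q w′) (trans same (sym (δ*≡foldl q w))) , short

  pumpDown-δ*² : ∀ p q (w : Word (Fin k)) →
                 ∃[ w′ ] (δ* M p w′ ≡ δ* M p w × δ* M q w′ ≡ δ* M q w) × length w′ < n * n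
  pumpDown-δ*² p q w
    with w′ , same , short ← pumpDown (step-× (δ M) (δ M)) (↔⇒↣ (↔-sym *↔×)) (p , q) w
    = w′ , pairs-equal , short
    where
    pairs : ∀ u → (δ* M p u , δ* M q u) ≡ foldl (step-× (δ M) (δ M)) (p , q) u
    pairs u = trans (cong₂ _,_ (δ*≡foldl p u) (δ*≡foldl q u)) (sym (foldl-× (δ M) (δ M) p q u))
    pairs-equal : δ* M p w′ ≡ δ* M p w × δ* M q w′ ≡ δ* M q w
    pairs-equal = ×-≡,≡←≡ (trans (pairs w′) (trans same (sym (pairs w))))

  δ*-++³-cong : ∀ q {x x′ v v′ y y′ : Word (Fin k)} →
                δ* M q x′ ≡ δ* M q x →
                δ* M (δ* M q x) v′ ≡ δ* M (δ* M q x) v →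
                δ* M (δ* M (δ* M q x) v) y′ ≡ δ* M (δ* M (δ* M q x) v) y →
                δ* M q (x′ ++ v′ ++ y′) ≡ δ* M q (x ++ v ++ y)
  δ*-++³-cong q {x} {x′} {v} {v′} {y} {y′} x′~x v′~v y′~y = begin
    δ* M q (x′ ++ v′ ++ y′)                   ≡⟨ δ*-++³ q x′ v′ y′ ⟩
    δ* M (δ* M (δ* M q x′) v′) y′             ≡⟨ cong (λ p → δ* M (δ* M p v′) y′) x′~x ⟩
    δ* M (δ* M (δ* M q x) v′) y′              ≡⟨ cong (λ p → δ* M p y′) v′~v ⟩
    δ* M (δ* M (δ* M q x) v) y′               ≡⟨ y′~y ⟩
    δ* M (δ* M (δ* M q x) v) y                ≡⟨ δ*-++³ q x v y ⟨
    δ* M q (x ++ v ++ y) ∎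
    where open ≡-Reasoning

  -- v′ must mimic v both from the start state (so that v′ is still rejected) and
  -- from the state after x (so that x′v′y′ is still accepted); hence the n² bound.
  pumpDown-witness : ∀ x v y → Accepts M (x ++ v ++ y) → ¬ Accepts M v →
    ∃[ x′ ] ∃[ v′ ] ∃[ y′ ] Accepts M (x′ ++ v′ ++ y′) × ¬ Accepts M v′
                          × length x′ < n × length v′ < n * n × length y′ < n
  pumpDown-witness x v y accepted rejected
    with x′ , x′~x , ∣x′∣<n ← pumpDown-δ* (start M) x
    with v′ , (v′~v , v′~v-after-x) , ∣v′∣<n² ← pumpDown-δ*² (start M) (δ* M (start M) x) v
    with y′ , y′~y , ∣y′∣<n ← pumpDown-δ* (δ* M (δ* M (start M) x) v) y
    = x′ , v′ , y′
    , Accepts-resp (x ++ v ++ y) (x′ ++ v′ ++ y′)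
        (sym (δ*-++³-cong (start M) {x} {x′} {v} {v′} {y} {y′} x′~x v′~v-after-x y′~y)) accepted
    , (λ v′-accepted → rejected (Accepts-resp v′ v v′~v v′-accepted))
    , ∣x′∣<n , ∣v′∣<n² , ∣y′∣<n

  ShortWitness : ℕ → Set
  ShortWitness b = ∃[ x ] ∃[ v ] ∃[ y ]
    (Accepts M (x ++ v ++ y) × ¬ Accepts M v × length (x ++ v ++ y) ≤ b)

  shortWitness? : ∀ b → Dec (ShortWitness b)
  shortWitness? b =
    ∃-bounded? b (λ x → ∃-bounded? b (λ v → ∃-bounded? b (witness? x v) (y≤ x v)) (v≤ x)) x≤
    where
    Witness′ : Word (Fin k) → Word (Fin k) → Word (Fin k) → Set
    Witness′ x v y = Accepts M (x ++ v ++ y) × ¬ Accepts M v × length (x ++ v ++ y) ≤ b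
    witness? : ∀ x v y → Dec (Witness′ x v y)
    witness? x v y = accepts? (x ++ v ++ y) ×-dec ¬? (accepts? v) ×-dec (length (x ++ v ++ y) ≤? b)
    y≤ : ∀ x v y → Witness′ x v y → length y ≤ b
    y≤ x v y (_ , _ , ∣xvy∣≤b) =
      ≤-trans (length-++-≤ʳ y {v}) (≤-trans (length-++-≤ʳ (v ++ y) {x}) ∣xvy∣≤b)
    v≤ : ∀ x v → ∃[ y ] Witness′ x v y → length v ≤ b
    v≤ x v (y , _ , _ , ∣xvy∣≤b) =
      ≤-trans (length-++-≤ˡ v) (≤-trans (length-++-≤ʳ (v ++ y) {x}) ∣xvy∣≤b)
    x≤ : ∀ x → ∃[ v ] ∃[ y ] Witness′ x v y → length x ≤ b
    x≤ x (v , y , _ , _ , ∣xvy∣≤b) = ≤-trans (length-++-≤ˡ x) ∣xvy∣≤b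

n≤n*n : ∀ n → n ≤ n * n
n≤n*n zero    = z≤n
n≤n*n (suc n) = m≤m*n (suc n) (suc n)

length-++³-bound : ∀ {A : Set} n (x v y : List A) →
                   length x < n → length v < n * n → length y < n →
                   length (x ++ v ++ y) ≤ 2 * (n * n) + n ∸ 1
length-++³-bound n x v y ∣x∣<n ∣v∣<n² ∣y∣<n = ∸-monoˡ-≤ 1 (begin
  suc (length (x ++ v ++ y))             ≡⟨ cong suc (trans (length-++ x) (cong (length x +_) (length-++ v))) ⟩
  suc (length x + (length v + length y)) ≤⟨ +-mono-≤ ∣x∣<n (+-mono-≤ (<⇒≤ ∣v∣<n²) (<⇒≤ ∣y∣<n)) ⟩
  n + (n * n + n)                        ≤⟨ +-monoˡ-≤ (n * n + n) (n≤n*n n) ⟩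
  n * n + (n * n + n)                    ≡⟨ +-assoc (n * n) (n * n) n ⟨
  n * n + n * n + n                      ≡⟨ cong (λ m → n * n + m + n) (+-identityʳ (n * n)) ⟨
  2 * (n * n) + n                        ∎)
  where open ≤-Reasoning

corollary4 : (k n : ℕ) (M : DFA (Fin k) n) →
    ¬ FactorClosed (Accepts M) →
    ∃[ v ] ∃[ w ] (Witness (Accepts M) v w × length w ≤ 2 * (n * n) + n ∸ 1)
corollary4 k n M notClosed with shortWitness? M (2 * (n * n) + n ∸ 1)
... | yes (x , v , y , accepted , rejected , short) =
  v , x ++ v ++ y , (accepted , rejected , x , y , refl) , short
... | no noShortWitness = ⊥-elim (notClosed closed)
  where
  closed : FactorClosed (Accepts M)
  closed v w accepted (x , y , refl) = decidable-stable (accepts? M v) λ rejected →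
    let x′ , v′ , y′ , accepted′ , rejected′ , ∣x′∣<n , ∣v′∣<n² , ∣y′∣<n =
          pumpDown-witness M x v y accepted rejected
    in noShortWitness
         (x′ , v′ , y′ , accepted′ , rejected′ , length-++³-bound n x′ v′ y′ ∣x′∣<n ∣v′∣<n² ∣y′∣<n)
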